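{- Let $\mathbf R=(R,\leq,\odot,\rightarrow,\leadsto,\bar{}\,,\tilde{}\,,0,1)$ be an unsharp residuated poset and define, for $x,y\in R$, $x+y:=\widetilde{\bar x\odot\bar y}$, defined if and only if $x\leq\bar y$. Then $(R,+,\bar{}\,,\tilde{}\,,0,1)$ is a good pseudoeffect algebra whose induced order coincides with $\leq$.
   Context: For a poset and $A\subseteq R$: $L(A)=\{x\mid x\leq y\ \forall y\in A\}$, $U(A)=\{x\mid y\leq x\ \forall y\in A\}$; $L(a,b)=L(\{a,b\})$, $U(a,b)=U(\{a,b\})$, $LU(A)=L(U(A))$, $UL(a,b)=U(L(\{a,b\}))$. For subsets $A,B$, $A\leq B$ means $x\leq y$ for all $x\in A,y\in B$. Operations are extended elementwise to subsets, e.g. $A\odot y=\{u\odot y\mid u\in A\}$, $y\odot A=\{y\odot u\mid u\in A\}$. We write $\widetilde{t}$ and $\overline{t}$ for the unary operations applied to a term $t$. A partial monoid $(R,\odot,1)$ is a set with a partial binary operation such that $(x\odot y)\odot z$ is defined iff $x\odot(y\odot z)$ is defined and then they are equal, and $x\odot1=1\odot x=x$. An unsharp residuated poset is a tuple $(R,\leq,\odot,\rightarrow,\leadsto,\bar{}\,,\tilde{}\,,0,1)$ with $\rightarrow,\leadsto:R^2\to 2^R$ and unary operations $\bar{}\,,\tilde{}$ such that for all $x,y,z\in R$: (R1) $(R,\leq,0,1)$ is a bounded poset; (R2) $\tilde{\bar x}=\bar{\tilde x}=x$, and $x\leq y$ implies $\bar y\leq\bar x$ and $\tilde y\leq\tilde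 x$; (R3) $(R,\odot,1)$ is a partial monoid where $x\odot y$ is defined iff $\tilde x\leq y$, and $\bar z\leq x\leq y$ implies $x\odot z\leq y\odot z$, and $\tilde z\leq x\leq y$ implies $z\odot x\leq z\odot y$; (R4) $L(U(x,\bar y)\odot y)\leq UL(y,z)$ iff $LU(x,\bar y)\leq U(y\rightarrow z)$; (R5) $L(y\odot U(x,\tilde y))\leq UL(y,z)$ iff $LU(x,\tilde y)\leq U(y\leadsto z)$; (R6) $x\rightarrow0=\{\bar x\}$ and $x\leadsto 0=\{\tilde x\}$; (R7) $\widetilde{\bar x\odot\bar y}=\overline{\tilde x\odot\tilde y}$. A pseudoeffect algebra is a partial algebra $(P,+,\bar{}\,,\tilde{}\,,0,1)$ of type $(2,1,1,0,0)$ where $(P,\bar{}\,,\tilde{}\,,0,1)$ is an algebra and $+$ is a partial binary operation such that for all $x,y,z\in P$: (P1) if $x+y$ is defined then there exist $u,w\in P$ with $u+x=y+w=x+y$; (P2) $(x+y)+z$ is defined iff $x+(y+z)$ is defined, and then they are equal; (P3) $\bar x$ is the unique $u$ with $u+x=1$ and $\tilde x$ is the unique $w$ with $x+w=1$; (P4) if $1+x$ or $x+1$ is defined then $x=0$. Its induced order is $x\leq y$ iff there is $z$ with $x+z=y$. It is good if $\widetilde{\bar x+\bar y}=\overline{\tilde x+\tilde y}$ for all $x,y$ with $\tilde x\leq y$. -}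

module Defs where

open import Data.Product using (Σ; ∃; _×_; _,_)
open import Data.Sum using (_⊎_)
open import Relation.Binary.PropositionalEquality using (_≡_)
open import Relation.Binary.Structures using (IsPartialOrder)
open import Function.Bundles using (_⇔_)

Subset : Set → Set₁
Subset R = R → Set

module PosetNotions {R : Set} (_≤_ : R → R → Set) where

  L : Subset R → Subset R
  L A x = ∀ y → A y → x ≤ y

  U : Subset R → Subset R
  U A x = ∀ y → A y → y ≤ x

  ⟪_,_⟫ : R → R → Subset R
  ⟪ a , b ⟫ v = (v ≡ a) ⊎ (v ≡ b)

  _≤ˢ_ : Subset R → Subset R → Set
  A ≤ˢ B = ∀ x y → A x → B y → x ≤ y

imageʳ : {R : Set} → (R → R → R) → Subset R → R → Subset R
imageʳ _⊙_ A y v = Σ _ λ u → A u × (v ≡ u ⊙ y)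

imageˡ : {R : Set} → (R → R → R) → R → Subset R → Subset R
imageˡ _⊙_ y A v = Σ _ λ u → A u × (v ≡ y ⊙ u)

-- Partial operations are modelled as total functions together with a
-- definedness predicate; all axioms only constrain defined values.
-- For ⊙ the definedness predicate is fixed by (R3):  x ⊙ y defined iff ~x ≤ y.
record IsUnsharpResiduatedPoset
  (R : Set) (_≤_ : R → R → Set) (_⊙_ : R → R → R)
  (_⇒_ _↝_ : R → R → Subset R)
  (bar tilde : R → R) (𝟎 𝟏 : R) : Set where
  open PosetNotions _≤_
  field
    isPartialOrder : IsPartialOrder _≡_ _≤_
    bottom : ∀ x → 𝟎 ≤ x
    top    : ∀ x → x ≤ 𝟏
    tilde-bar : ∀ x → tilde (bar x) ≡ x
    bar-tilde : ∀ x → bar (tilde x) ≡ x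
    bar-anti   : ∀ x y → x ≤ y → bar y ≤ bar x
    tilde-anti : ∀ x y → x ≤ y → tilde y ≤ tilde x
    assoc-def : ∀ x y z →
      ((tilde x ≤ y) × (tilde (x ⊙ y) ≤ z)) ⇔ ((tilde y ≤ z) × (tilde x ≤ (y ⊙ z)))
    assoc : ∀ x y z → tilde x ≤ y → tilde (x ⊙ y) ≤ z →
      (x ⊙ y) ⊙ z ≡ x ⊙ (y ⊙ z)
    unitʳ-def : ∀ x → tilde x ≤ 𝟏
    unitˡ-def : ∀ x → tilde 𝟏 ≤ x
    unitʳ : ∀ x → x ⊙ 𝟏 ≡ x
    unitˡ : ∀ x → 𝟏 ⊙ x ≡ x
    mono-left  : ∀ x y z → bar z ≤ x → x ≤ y → (x ⊙ z) ≤ (y ⊙ z)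
    mono-right : ∀ x y z → tilde z ≤ x → x ≤ y → (z ⊙ x) ≤ (z ⊙ y)
    adj→ : ∀ x y z →
      (L (imageʳ _⊙_ (U ⟪ x , bar y ⟫) y) ≤ˢ U (L ⟪ y , z ⟫))
        ⇔ (L (U ⟪ x , bar y ⟫) ≤ˢ U (y ⇒ z))
    adj↝ : ∀ x y z →
      (L (imageˡ _⊙_ y (U ⟪ x , tilde y ⟫)) ≤ˢ U (L ⟪ y , z ⟫))
        ⇔ (L (U ⟪ x , tilde y ⟫) ≤ˢ U (y ↝ z))
    neg→ : ∀ x v → (x ⇒ 𝟎) v ⇔ (v ≡ bar x)
    neg↝ : ∀ x v → (x ↝ 𝟎) v ⇔ (v ≡ tilde x)
    -- (R7), required whenever both sides are defined
    good : ∀ x y → tilde (bar x) ≤ bar y → tilde (tilde x) ≤ tilde y →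
      tilde (bar x ⊙ bar y) ≡ bar (tilde x ⊙ tilde y)

-- Pseudoeffect algebra with partial + given by a total function and a
-- definedness predicate D (x + y is defined iff D x y).
record IsPseudoEffectAlgebra
  (P : Set) (D : P → P → Set) (_+_ : P → P → P)
  (bar tilde : P → P) (𝟎 𝟏 : P) : Set where
  field
    P1 : ∀ x y → D x y →
      Σ P λ u → Σ P λ w →
        D u x × (u + x ≡ x + y) × D y w × (y + w ≡ x + y)
    P2-def : ∀ x y z → (D x y × D (x + y) z) ⇔ (D y z × D x (y + z))
    P2     : ∀ x y z → D x y → D (x + y) z → (x + y) + z ≡ x + (y + z)
    P3-bar       : ∀ x → D (bar x) x × (bar x + x ≡ 𝟏)
    P3-bar-uniq  : ∀ x u → D u x → u + x ≡ 𝟏 → u ≡ bar x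
    P3-tilde      : ∀ x → D x (tilde x) × (x + tilde x ≡ 𝟏)
    P3-tilde-uniq : ∀ x w → D x w → x + w ≡ 𝟏 → w ≡ tilde x
    P4ˡ : ∀ x → D 𝟏 x → x ≡ 𝟎
    P4ʳ : ∀ x → D x 𝟏 → x ≡ 𝟎

inducedOrder : {P : Set} (D : P → P → Set) (_+_ : P → P → P) → P → P → Set
inducedOrder {P} D _+_ x y = Σ P λ z → D x z × (x + z ≡ y)

-- good pseudoeffect algebra; the equation is required whenever both sides
-- are defined
record IsGoodPseudoEffectAlgebra
  (P : Set) (D : P → P → Set) (_+_ : P → P → P)
  (bar tilde : P → P) (𝟎 𝟏 : P) : Set where
  field
    isPEA : IsPseudoEffectAlgebra P D _+_ bar tilde 𝟎 𝟏
    isGood : ∀ x y → inducedOrder D _+_ (tilde x) y →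
      D (bar x) (bar y) → D (tilde x) (tilde y) →
      tilde (bar x + bar y) ≡ bar (tilde x + tilde y)

-- The sum x + y = tilde (bar x ⊙ bar y) is the product ⊙ transported along the
-- order-reversing involutions, so (P2) is the associativity of ⊙, and
-- x ≤ x + y, y ≤ x + y come from a ⊙ b ≤ a, b. Everything else comes from the
-- cases z = 0 of the residuation laws (R4), (R5): as y ⇒ 0 = {bar y} and
-- y ↝ 0 = {tilde y}, they say that bar y ⊙ y = 0 and that a ⊙ y = 0
-- (resp. y ⊙ a = 0) forces a ≤ bar y (resp. a ≤ tilde y). This yields the
-- uniqueness of complements in (P3); the differences needed for (P1) and for
-- the induced order are then built from complements, e.g.
-- s = x + tilde (bar s + x) whenever x ≤ s.
module Submission where

open import Defs
open import Data.Product using (_×_; _,_; Σ; proj₁; proj₂)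
open import Data.Product.Function.NonDependent.Propositional using (_×-⇔_)
open import Data.Sum using (inj₁; inj₂)
open import Function using (_∘_)
open import Function.Bundles using (_⇔_; mk⇔; Equivalence)
import Function.Properties.Equivalence as ⇔
open import Relation.Binary.PropositionalEquality
  using (_≡_; refl; sym; trans; cong; cong₂; subst; subst₂; module ≡-Reasoning)
open import Relation.Binary.Structures using (IsPartialOrder)

module UnsharpResiduatedPosetProperties
    {R : Set} {_≤_ : R → R → Set} {_⊙_ : R → R → R}
    {_⇒_ _↝_ : R → R → Subset R} {bar tilde : R → R} {𝟎 𝟏 : R}
    (isURP : IsUnsharpResiduatedPoset R _≤_ _⊙_ _⇒_ _↝_ bar tilde 𝟎 𝟏) where

  open IsUnsharpResiduatedPoset isURP
  open PosetNotions _≤_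
  open IsPartialOrder isPartialOrder
    using (antisym) renaming (refl to ≤-refl; trans to ≤-trans; reflexive to ≤-reflexive)
  open Equivalence using (to; from)

  ≤-cong : ∀ {a a′ b b′} → a ≡ a′ → b ≡ b′ → (a ≤ b) ⇔ (a′ ≤ b′)
  ≤-cong refl refl = ⇔.refl

  U-pair : ∀ {a b c} → a ≤ c → b ≤ c → U ⟪ a , b ⟫ c
  U-pair a≤c _   _ (inj₁ refl) = a≤c
  U-pair _   b≤c _ (inj₂ refl) = b≤c

  ≤bar⇒≤tilde : ∀ {x y} → x ≤ bar y → y ≤ tilde x
  ≤bar⇒≤tilde {x} {y} x≤y⁻ = subst (_≤ tilde x) (tilde-bar y) (tilde-anti _ _ x≤y⁻)

  bar-reflects : ∀ {x y} → bar x ≤ bar y → y ≤ x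
  bar-reflects {x} {y} = subst₂ _≤_ (tilde-bar y) (tilde-bar x) ∘ tilde-anti _ _

  bar-injective : ∀ {x y} → bar x ≡ bar y → x ≡ y
  bar-injective {x} {y} x⁻≡y⁻ = trans (sym (tilde-bar x)) (trans (cong tilde x⁻≡y⁻) (tilde-bar y))

  tilde-injective : ∀ {x y} → tilde x ≡ tilde y → x ≡ y
  tilde-injective {x} {y} x~≡y~ = trans (sym (bar-tilde x)) (trans (cong bar x~≡y~) (bar-tilde y))

  tilde-𝟎 : tilde 𝟎 ≡ 𝟏
  tilde-𝟎 = antisym (top _) (subst (_≤ tilde 𝟎) (tilde-bar 𝟏) (tilde-anti _ _ (bottom (bar 𝟏))))

  bar-𝟏 : bar 𝟏 ≡ 𝟎
  bar-𝟏 = trans (cong bar (sym tilde-𝟎)) (bar-tilde 𝟎)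

  tilde-𝟏 : tilde 𝟏 ≡ 𝟎
  tilde-𝟏 = antisym (subst (tilde 𝟏 ≤_) (tilde-bar 𝟎) (tilde-anti _ _ (top (bar 𝟎)))) (bottom _)

  x⊙y≤x : ∀ {x y} → tilde x ≤ y → (x ⊙ y) ≤ x
  x⊙y≤x {x} {y} x~≤y = ≤-trans (mono-right y 𝟏 x x~≤y (top y)) (≤-reflexive (unitʳ x))

  x⊙y≤y : ∀ {x y} → tilde x ≤ y → (x ⊙ y) ≤ y
  x⊙y≤y {x} {y} x~≤y = ≤-trans (mono-left x 𝟏 y y⁻≤x (top x)) (≤-reflexive (unitˡ y))
    where
    y⁻≤x : bar y ≤ x
    y⁻≤x = subst (bar y ≤_) (bar-tilde x) (bar-anti _ _ x~≤y)

  bar-x⊙x≡𝟎 : ∀ x → bar x ⊙ x ≡ 𝟎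
  bar-x⊙x≡𝟎 x = antisym (from (adj→ (bar x) x 𝟎) residual (bar x ⊙ x) 𝟎 lower upper) (bottom _)
    where
    residual : L (U ⟪ bar x , bar x ⟫) ≤ˢ U (x ⇒ 𝟎)
    residual a c a-lower c-upper =
      ≤-trans (a-lower (bar x) (U-pair ≤-refl ≤-refl)) (c-upper (bar x) (from (neg→ x (bar x)) refl))
    lower : L (imageʳ _⊙_ (U ⟪ bar x , bar x ⟫) x) (bar x ⊙ x)
    lower _ (u , u-upper , refl) = mono-left (bar x) u x ≤-refl (u-upper (bar x) (inj₁ refl))
    upper : U (L ⟪ x , 𝟎 ⟫) 𝟎
    upper v v-lower = v-lower 𝟎 (inj₂ refl)

  x⊙y≡𝟎⇒x≤bar-y : ∀ {x y} → bar y ≤ x → x ⊙ y ≡ 𝟎 → x ≤ bar y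
  x⊙y≡𝟎⇒x≤bar-y {x} {y} y⁻≤x x⊙y≡𝟎 = to (adj→ x y 𝟎) below-𝟎 x (bar y) lower upper
    where
    below-𝟎 : L (imageʳ _⊙_ (U ⟪ x , bar y ⟫) y) ≤ˢ U (L ⟪ y , 𝟎 ⟫)
    below-𝟎 p c p-lower _ =
      ≤-trans (p-lower (x ⊙ y) (x , U-pair ≤-refl y⁻≤x , refl)) (≤-trans (≤-reflexive x⊙y≡𝟎) (bottom c))
    lower : L (U ⟪ x , bar y ⟫) x
    lower v v-upper = v-upper x (inj₁ refl)
    upper : U (y ⇒ 𝟎) (bar y)
    upper v v∈y⇒𝟎 = ≤-reflexive (to (neg→ y v) v∈y⇒𝟎)

  y⊙x≡𝟎⇒x≤tilde-y : ∀ {x y} → tilde y ≤ x → y ⊙ x ≡ 𝟎 → x ≤ tilde y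
  y⊙x≡𝟎⇒x≤tilde-y {x} {y} y~≤x y⊙x≡𝟎 = to (adj↝ x y 𝟎) below-𝟎 x (tilde y) lower upper
    where
    below-𝟎 : L (imageˡ _⊙_ y (U ⟪ x , tilde y ⟫)) ≤ˢ U (L ⟪ y , 𝟎 ⟫)
    below-𝟎 p c p-lower _ =
      ≤-trans (p-lower (y ⊙ x) (x , U-pair ≤-refl y~≤x , refl)) (≤-trans (≤-reflexive y⊙x≡𝟎) (bottom c))
    lower : L (U ⟪ x , tilde y ⟫) x
    lower v v-upper = v-upper x (inj₁ refl)
    upper : U (y ↝ 𝟎) (tilde y)
    upper v v∈y↝𝟎 = ≤-reflexive (to (neg↝ y v) v∈y↝𝟎)

  module InducedPseudoEffectAlgebra where

    Defined : R → R → Set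
    Defined x y = x ≤ bar y

    _+_ : R → R → R
    x + y = tilde (bar x ⊙ bar y)

    bar-+ : ∀ x y → bar (x + y) ≡ bar x ⊙ bar y
    bar-+ x y = bar-tilde (bar x ⊙ bar y)

    Defined⇒⊙-defined : ∀ {x y} → Defined x y → tilde (bar x) ≤ bar y
    Defined⇒⊙-defined = to (≤-cong (sym (tilde-bar _)) refl)

    +-complementˡ : ∀ x → Defined (bar x) x × (bar x + x ≡ 𝟏)
    +-complementˡ x = ≤-refl , trans (cong tilde (bar-x⊙x≡𝟎 (bar x))) tilde-𝟎

    +-complementʳ : ∀ x → Defined x (tilde x) × (x + tilde x ≡ 𝟏)
    +-complementʳ x = ≤-reflexive (sym (bar-tilde x)) , (begin
      tilde (bar x ⊙ bar (tilde x)) ≡⟨ cong (λ v → tilde (bar x ⊙ v)) (bar-tilde x) ⟩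
      tilde (bar x ⊙ x)             ≡⟨ cong tilde (bar-x⊙x≡𝟎 x) ⟩
      tilde 𝟎                       ≡⟨ tilde-𝟎 ⟩
      𝟏                             ∎)
      where open ≡-Reasoning

    bar-+≡𝟎 : ∀ {x y} → x + y ≡ 𝟏 → bar x ⊙ bar y ≡ 𝟎
    bar-+≡𝟎 {x} {y} x+y≡𝟏 = trans (sym (bar-+ x y)) (trans (cong bar x+y≡𝟏) bar-𝟏)

    +-complementˡ-unique : ∀ x u → Defined u x → u + x ≡ 𝟏 → u ≡ bar x
    +-complementˡ-unique x u u≤x⁻ u+x≡𝟏 = antisym u≤x⁻ (bar-reflects u⁻≤x⁻⁻)
      where
      u⁻≤x⁻⁻ : bar u ≤ bar (bar x)
      u⁻≤x⁻⁻ = x⊙y≡𝟎⇒x≤bar-y (bar-anti _ _ u≤x⁻) (bar-+≡𝟎 u+x≡𝟏)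

    +-complementʳ-unique : ∀ x w → Defined x w → x + w ≡ 𝟏 → w ≡ tilde x
    +-complementʳ-unique x w x≤w⁻ x+w≡𝟏 = antisym (≤bar⇒≤tilde x≤w⁻) x~≤w
      where
      w⁻≤x : bar w ≤ x
      w⁻≤x = subst (bar w ≤_) (tilde-bar x)
        (y⊙x≡𝟎⇒x≤tilde-y (Defined⇒⊙-defined x≤w⁻) (bar-+≡𝟎 x+w≡𝟏))
      x~≤w : tilde x ≤ w
      x~≤w = subst (tilde x ≤_) (tilde-bar w) (tilde-anti _ _ w⁻≤x)

    Defined-𝟏ˡ : ∀ x → Defined 𝟏 x → x ≡ 𝟎
    Defined-𝟏ˡ x 𝟏≤x⁻ = trans (sym (tilde-bar x)) (trans (cong tilde (antisym (top _) 𝟏≤x⁻)) tilde-𝟏)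

    Defined-𝟏ʳ : ∀ x → Defined x 𝟏 → x ≡ 𝟎
    Defined-𝟏ʳ x x≤𝟏⁻ = antisym (≤-trans x≤𝟏⁻ (≤-reflexive bar-𝟏)) (bottom x)

    +-assoc-defined : ∀ x y z →
      (Defined x y × Defined (x + y) z) ⇔ (Defined y z × Defined x (y + z))
    +-assoc-defined x y z =
      ⇔.trans (≤-cong (sym (tilde-bar x)) refl ×-⇔ ⇔.refl)
        (⇔.trans (assoc-def (bar x) (bar y) (bar z))
          (≤-cong (tilde-bar y) refl ×-⇔ ≤-cong (tilde-bar x) (sym (bar-+ y z))))

    +-assoc : ∀ x y z → Defined x y → Defined (x + y) z → (x + y) + z ≡ x + (y + z)
    +-assoc x y z x≤y⁻ x+y≤z⁻ = begin
      tilde (bar (x + y) ⊙ bar z)       ≡⟨ cong (λ v → tilde (v ⊙ bar z)) (bar-+ x y) ⟩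
      tilde ((bar x ⊙ bar y) ⊙ bar z)   ≡⟨ cong tilde (assoc (bar x) (bar y) (bar z) (Defined⇒⊙-defined x≤y⁻) x+y≤z⁻) ⟩
      tilde (bar x ⊙ (bar y ⊙ bar z))   ≡⟨ cong (λ v → tilde (bar x ⊙ v)) (bar-+ y z) ⟨
      tilde (bar x ⊙ bar (y + z))       ∎
      where open ≡-Reasoning

    x≤x+y : ∀ {x y} → Defined x y → x ≤ (x + y)
    x≤x+y {x} {y} = subst (_≤ (x + y)) (tilde-bar x) ∘ tilde-anti _ _ ∘ x⊙y≤x ∘ Defined⇒⊙-defined

    y≤x+y : ∀ {x y} → Defined x y → y ≤ (x + y)
    y≤x+y {x} {y} = subst (_≤ (x + y)) (tilde-bar y) ∘ tilde-anti _ _ ∘ x⊙y≤y ∘ Defined⇒⊙-defined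

    right-difference : ∀ {x s} → x ≤ s → Σ R λ w → Defined x w × (x + w ≡ s)
    right-difference {x} {s} x≤s = w , x≤w⁻ , sym (bar-injective s⁻≡x+w⁻)
      where
      q w : R
      q = bar s + x
      w = tilde q
      s⁻≤x⁻ : Defined (bar s) x
      s⁻≤x⁻ = bar-anti _ _ x≤s
      q≤w⁻ : Defined q w
      q≤w⁻ = proj₁ (+-complementʳ q)
      reassociated : Defined x w × Defined (bar s) (x + w)
      reassociated = to (+-assoc-defined (bar s) x w) (s⁻≤x⁻ , q≤w⁻)
      x≤w⁻ : Defined x w
      x≤w⁻ = proj₁ reassociated
      s⁻≡x+w⁻ : bar s ≡ bar (x + w)
      s⁻≡x+w⁻ = +-complementˡ-unique (x + w) (bar s) (proj₂ reassociated)
        (trans (sym (+-assoc (bar s) x w s⁻≤x⁻ q≤w⁻)) (proj₂ (+-complementʳ q)))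

    left-difference : ∀ {x s} → x ≤ s → Σ R λ u → Defined u x × (u + x ≡ s)
    left-difference {x} {s} x≤s = u , u≤x⁻ , sym (tilde-injective s~≡u+x~)
      where
      q u : R
      q = x + tilde s
      u = bar q
      x≤s~⁻ : Defined x (tilde s)
      x≤s~⁻ = subst (x ≤_) (sym (bar-tilde s)) x≤s
      u≤q⁻ : Defined u q
      u≤q⁻ = proj₁ (+-complementˡ q)
      reassociated : Defined u x × Defined (u + x) (tilde s)
      reassociated = from (+-assoc-defined u x (tilde s)) (x≤s~⁻ , u≤q⁻)
      u≤x⁻ : Defined u x
      u≤x⁻ = proj₁ reassociated
      u+x≤s~⁻ : Defined (u + x) (tilde s)
      u+x≤s~⁻ = proj₂ reassociated
      s~≡u+x~ : tilde s ≡ tilde (u + x)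
      s~≡u+x~ = +-complementʳ-unique (u + x) (tilde s) u+x≤s~⁻
        (trans (+-assoc u x (tilde s) u≤x⁻ u+x≤s~⁻) (proj₂ (+-complementˡ q)))

    +-differences : ∀ x y → Defined x y → Σ R λ u → Σ R λ w →
      Defined u x × (u + x ≡ x + y) × Defined y w × (y + w ≡ x + y)
    +-differences x y x≤y⁻ with left-difference (x≤x+y x≤y⁻) | right-difference (y≤x+y x≤y⁻)
    ... | u , u≤x⁻ , u+x≡x+y | w , y≤w⁻ , y+w≡x+y = u , w , u≤x⁻ , u+x≡x+y , y≤w⁻ , y+w≡x+y

    inducedOrder⇔≤ : ∀ x y → inducedOrder Defined _+_ x y ⇔ (x ≤ y)
    inducedOrder⇔≤ x y = mk⇔ (λ { (z , x≤z⁻ , refl) → x≤x+y x≤z⁻ }) right-difference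

    isPseudoEffectAlgebra : IsPseudoEffectAlgebra R Defined _+_ bar tilde 𝟎 𝟏
    isPseudoEffectAlgebra = record
      { P1 = +-differences
      ; P2-def = +-assoc-defined
      ; P2 = +-assoc
      ; P3-bar = +-complementˡ
      ; P3-bar-uniq = +-complementˡ-unique
      ; P3-tilde = +-complementʳ
      ; P3-tilde-uniq = +-complementʳ-unique
      ; P4ˡ = Defined-𝟏ˡ
      ; P4ʳ = Defined-𝟏ʳ
      }

    -- (R7) at bar x, bar y already gives the equation.
    +-good : ∀ x y → inducedOrder Defined _+_ (tilde x) y →
      Defined (bar x) (bar y) → Defined (tilde x) (tilde y) →
      tilde (bar x + bar y) ≡ bar (tilde x + tilde y)
    +-good x y x~⊑y x⁻≤y⁻⁻ _ = begin
      tilde (bar x + bar y)                           ≡⟨ cong tilde (good (bar x) (bar y) x⁻⁻~≤y⁻⁻ x⁻~~≤y⁻~) ⟩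
      tilde (bar (tilde (bar x) ⊙ tilde (bar y)))     ≡⟨ tilde-bar _ ⟩
      tilde (bar x) ⊙ tilde (bar y)                   ≡⟨ cong₂ _⊙_ (tilde-bar x) (tilde-bar y) ⟩
      x ⊙ y                                           ≡⟨ cong₂ _⊙_ (bar-tilde x) (bar-tilde y) ⟨
      bar (tilde x) ⊙ bar (tilde y)                   ≡⟨ bar-+ (tilde x) (tilde y) ⟨
      bar (tilde x + tilde y)                         ∎
      where
      open ≡-Reasoning
      x⁻⁻~≤y⁻⁻ : tilde (bar (bar x)) ≤ bar (bar y)
      x⁻⁻~≤y⁻⁻ = Defined⇒⊙-defined x⁻≤y⁻⁻
      x⁻~~≤y⁻~ : tilde (tilde (bar x)) ≤ tilde (bar y)
      x⁻~~≤y⁻~ = subst₂ _≤_ (cong tilde (sym (tilde-bar x))) (sym (tilde-bar y))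
        (to (inducedOrder⇔≤ (tilde x) y) x~⊑y)

    isGoodPseudoEffectAlgebra : IsGoodPseudoEffectAlgebra R Defined _+_ bar tilde 𝟎 𝟏
    isGoodPseudoEffectAlgebra = record { isPEA = isPseudoEffectAlgebra ; isGood = +-good }

theorem5 : (R : Set) (_≤_ : R → R → Set) (_⊙_ : R → R → R)
    (_⇒_ _↝_ : R → R → Subset R) (bar tilde : R → R) (𝟎 𝟏 : R) →
    IsUnsharpResiduatedPoset R _≤_ _⊙_ _⇒_ _↝_ bar tilde 𝟎 𝟏 →
    IsGoodPseudoEffectAlgebra R (λ x y → x ≤ bar y) (λ x y → tilde (bar x ⊙ bar y)) bar tilde 𝟎 𝟏
    × (∀ x y → inducedOrder (λ a b → a ≤ bar b) (λ a b → tilde (bar a ⊙ bar b)) x y ⇔ (x ≤ y))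
theorem5 _ _ _ _ _ _ _ _ _ isURP = isGoodPseudoEffectAlgebra , inducedOrder⇔≤
  where open UnsharpResiduatedPosetProperties.InducedPseudoEffectAlgebra isURP
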